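{- Suppose $\Omega=\{\omega\}$ is a singleton. Then for all $P,Q\in\mathsf{pCSP}$: (1) $P\,\overline\sqsubseteq^{\Omega}_{\mathrm{pmay}}\,Q$ iff $P\,\overline\sqsubseteq_{\mathrm{pmay}}\,Q$; (2) $P\,\overline\sqsubseteq^{\Omega}_{\mathrm{pmust}}\,Q$ iff $P\,\overline\sqsubseteq_{\mathrm{pmust}}\,Q$.
   Context: Processes. Let $\mathsf{Act}$ be a finite set of visible actions, $\tau\notin\mathsf{Act}$, $\mathsf{Act}_\tau=\mathsf{Act}\cup\{\tau\}$. Terms: $P::=S\mid P\oplus_pP$ ($0<p<1$), $S::=\mathbf 0\mid a.P\mid P\sqcap P\mid S\Box S\mid S|_AS$; $\mathsf{pCSP}$ = all terms, $\mathsf{sCSP}$ = sort $S$; $\Box,|_A$ on non-state-based terms distribute over $\oplus_p$. Finitely supported distributions, $[\![s]\!]=\overline s$, $[\![P\oplus_pQ]\!]=p[\![P]\!]+(1-p)[\![Q]\!]$. Transitions: $a.P\xrightarrow{a}[\![P]\!]$; $P\sqcap Q\xrightarrow{\tau}[\![P]\!],[\![Q]\!]$; visible moves of $s_1$ or $s_2$ are moves of $s_1\Box s_2$; a $\tau$-move $s_1\xrightarrow{\tau}\Delta$ gives $s_1\Box s_2\xrightarrow{\tau}\Delta\Box s_2$ (symmetrically); $s_1\xrightarrow{\alpha}\Delta$, $\alpha\notin A$, gives $s_1|_As_2\xrightarrow{\alpha}\Delta|_As_2$ (symmetrically); $s_i\xrightarrow{a}\Delta_i$ with $a\in A$ gives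 $s_1|_As_2\xrightarrow{\tau}\Delta_1|_A\Delta_2$. Action-based scalar testing: tests allow extra subterms $\omega.P$ ($\omega\notin\mathsf{Act}_\tau$, treated as visible action outside $\mathsf{Act}$); $\overline{\mathbb V}(s)=\bigcup\{\overline{\mathbb V}(\Delta):s\xrightarrow{\alpha}\Delta,\alpha\neq\omega\}\cup\{1:\text{if }s\xrightarrow{\omega}\}$ if $s$ has a transition, $\{0\}$ otherwise; $\overline{\mathbb V}(\Delta)=\{\sum_s\Delta(s)f(s):f(s)\in\overline{\mathbb V}(s)\}$; $\overline{\mathcal A}(T,P)=\overline{\mathbb V}([\![T|_{\mathsf{Act}}P]\!])$; $P\overline\sqsubseteq_{\mathrm{pmay}}Q$ iff $\overline{\mathcal A}(T,P)\le_{Ho}\overline{\mathcal A}(T,Q)$ for all tests, $P\overline\sqsubseteq_{\mathrm{pmust}}Q$ iff $\overline{\mathcal A}(T,P)\le_{Sm}\overline{\mathcal A}(T,Q)$ for all tests, where $X\le_{Ho}Y$ iff $\forall x\in X\exists y\in Y:x\le y$ and $X\le_{Sm}Y$ iff $\forall y\in Y\exists x\in X:x\le y$. Vector-based testing: $\Omega$ is a set of success actions disjoint from $\mathsf{Act}_\tau$; $\Omega$-tests allow subterms $\omega'.P$ for any $\omega'\in\Omega$. For $\alpha\in\mathsf{Act}_\tau\cup\Omega$, $\alpha!:[0,1]^\Omega\to[0,1]^\Omega$ sets component $\alpha$ to 1 if $\alpha\in\Omega$ and is the identity otherwise (lifted to sets). ${\updownarrow}X$ is the set of finite convex combinations of elements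 of $X$; $\vec 0$ the zero vector. $\overline{\mathbb V}^\Omega_{\updownarrow}(s)={\updownarrow}\bigcup\{\alpha!(\overline{\mathbb V}^\Omega_{\updownarrow}(\Delta)):s\xrightarrow{\alpha}\Delta,\alpha\in\Omega\cup\mathsf{Act}_\tau\}$ if $s$ has a transition, $\{\vec0\}$ otherwise; extended to distributions by $F(\Delta)=\{\sum_s\Delta(s)f(s):f(s)\in F(s)\}$. $\overline{\mathcal A}^\Omega_{\updownarrow}(T,P)=\overline{\mathbb V}^\Omega_{\updownarrow}([\![T|_{\mathsf{Act}}P]\!])$. With $\le$ componentwise on $[0,1]^\Omega$ and the corresponding Hoare/Smyth preorders, $P\overline\sqsubseteq^\Omega_{\mathrm{pmay}}Q$ iff $\overline{\mathcal A}^\Omega_{\updownarrow}(T,P)\le_{Ho}\overline{\mathcal A}^\Omega_{\updownarrow}(T,Q)$ for all $\Omega$-tests $T$, and $P\overline\sqsubseteq^\Omega_{\mathrm{pmust}}Q$ likewise with $\le_{Sm}$.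
   Formalization: The probabilities $0<p<1$ of processes and tests, the outcome values and the coefficients of the convex combinations in ${\updownarrow}X$ are rational, so P, Q and the tests range over rational-probability terms. -}

module Defs where

open import Data.Nat using (ℕ; zero; suc)
open import Data.Fin using (Fin; zero; suc)
open import Data.Bool using (Bool; true; false; if_then_else_)
open import Data.Empty using (⊥)
open import Data.Unit using (⊤; tt)
open import Data.Sum using (_⊎_; inj₁; inj₂)
open import Data.Product using (Σ; _×_; _,_; ∃)
open import Data.List using (List; []; _∷_; map; _++_; concatMap)
open import Data.List.Membership.Propositional using (_∈_)
open import Data.Rational using (ℚ; 0ℚ; 1ℚ; _+_; _*_; _-_; _≤_; _<_)
open import Relation.Binary.PropositionalEquality using (_≡_; _≢_)
open import Relation.Binary.Definitions using (DecidableEquality)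
open import Relation.Nullary using (¬_; yes; no)
open import Function using (_∘_; const)

-- Term Act X : terms over visible actions Act with extra
-- (success) actions X usable in prefixes.  pCSP processes: X = ⊥.
-- Tests: X = Ω.  Synchronisation sets A ⊆ Act are Boolean predicates.

mutual
  data Term (Act X : Set) : Set where
    st   : State Act X → Term Act X
    ⊕⟨_⟩ : (p : ℚ) → 0ℚ < p → p < 1ℚ → Term Act X → Term Act X → Term Act X

  data State (Act X : Set) : Set where
    nil  : State Act X
    pre  : Act ⊎ X → Term Act X → State Act X
    _⊓_  : Term Act X → Term Act X → State Act X
    _□_  : State Act X → State Act X → State Act X
    par  : (Act → Bool) → State Act X → State Act X → State Act X

pCSP : Set → Set
pCSP Act = Term Act ⊥

mutual
  embT : ∀ {Act X} → Term Act ⊥ → Term Act X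
  embT (st s) = st (embS s)
  embT (⊕⟨ p ⟩ h₁ h₂ P Q) = ⊕⟨ p ⟩ h₁ h₂ (embT P) (embT Q)

  embS : ∀ {Act X} → State Act ⊥ → State Act X
  embS nil = nil
  embS (pre (inj₁ a) P) = pre (inj₁ a) (embT P)
  embS (pre (inj₂ ()) P)
  embS (P ⊓ Q) = embT P ⊓ embT Q
  embS (s □ t) = embS s □ embS t
  embS (par A s t) = par A (embS s) (embS t)

-- Finitely supported distributions as weighted lists of states
-- (weights of repeated states add up).

Dist : Set → Set → Set
Dist Act X = List (ℚ × State Act X)

point : ∀ {Act X} → State Act X → Dist Act X
point s = (1ℚ , s) ∷ []

scale : ∀ {Act X} → ℚ → Dist Act X → Dist Act X
scale q = map (λ { (p , s) → (q * p , s) })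

mapD : ∀ {Act X} → (State Act X → State Act X) → Dist Act X → Dist Act X
mapD f = map (λ { (p , s) → (p , f s) })

prodD : ∀ {Act X} → (State Act X → State Act X → State Act X)
      → Dist Act X → Dist Act X → Dist Act X
prodD f Δ₁ Δ₂ = concatMap (λ { (p , s) → map (λ { (q , t) → (p * q , f s t) }) Δ₂ }) Δ₁

⟦_⟧ : ∀ {Act X} → Term Act X → Dist Act X
⟦ st s ⟧ = point s
⟦ ⊕⟨ p ⟩ _ _ P Q ⟧ = scale p ⟦ P ⟧ ++ scale (1ℚ - p) ⟦ Q ⟧

expect : ∀ {Act X} → (State Act X → ℚ) → Dist Act X → ℚ
expect f [] = 0ℚ
expect f ((p , s) ∷ Δ) = p * f s + expect f Δ

data Lab (Act X : Set) : Set where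
  τ   : Lab Act X
  act : Act ⊎ X → Lab Act X

NotIn : ∀ {Act X} → (Act → Bool) → Lab Act X → Set
NotIn A τ = ⊤
NotIn A (act (inj₁ a)) = A a ≡ false
NotIn A (act (inj₂ _)) = ⊤

data _─_⟶_ {Act X : Set} : State Act X → Lab Act X → Dist Act X → Set where
  pre⟶  : ∀ {a P} → pre a P ─ act a ⟶ ⟦ P ⟧
  intL  : ∀ {P Q} → (P ⊓ Q) ─ τ ⟶ ⟦ P ⟧
  intR  : ∀ {P Q} → (P ⊓ Q) ─ τ ⟶ ⟦ Q ⟧
  extL  : ∀ {s₁ s₂ a Δ} → s₁ ─ act a ⟶ Δ → (s₁ □ s₂) ─ act a ⟶ Δ
  extR  : ∀ {s₁ s₂ a Δ} → s₂ ─ act a ⟶ Δ → (s₁ □ s₂) ─ act a ⟶ Δ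
  extτL : ∀ {s₁ s₂ Δ} → s₁ ─ τ ⟶ Δ → (s₁ □ s₂) ─ τ ⟶ mapD (_□ s₂) Δ
  extτR : ∀ {s₁ s₂ Δ} → s₂ ─ τ ⟶ Δ → (s₁ □ s₂) ─ τ ⟶ mapD (s₁ □_) Δ
  parL  : ∀ {A s₁ s₂ α Δ} → s₁ ─ α ⟶ Δ → NotIn A α
        → par A s₁ s₂ ─ α ⟶ mapD (λ t → par A t s₂) Δ
  parR  : ∀ {A s₁ s₂ α Δ} → s₂ ─ α ⟶ Δ → NotIn A α
        → par A s₁ s₂ ─ α ⟶ mapD (λ t → par A s₁ t) Δ
  sync  : ∀ {A s₁ s₂ a Δ₁ Δ₂} → s₁ ─ act (inj₁ a) ⟶ Δ₁ → s₂ ─ act (inj₁ a) ⟶ Δ₂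
        → A a ≡ true → par A s₁ s₂ ─ τ ⟶ prodD (par A) Δ₁ Δ₂

NoTrans : ∀ {Act X} → State Act X → Set
NoTrans s = ∀ α Δ → ¬ (s ─ α ⟶ Δ)

testWith : ∀ {Act X} → Term Act X → pCSP Act → Dist Act X
testWith T P = prodD (par (const true)) ⟦ T ⟧ ⟦ embT P ⟧

ω : ∀ {Act} → Lab Act ⊤
ω = act (inj₂ tt)

data VS {Act : Set} : State Act ⊤ → ℚ → Set where
  v0  : ∀ {s} → NoTrans s → VS s 0ℚ
  vω  : ∀ {s Δ} → s ─ ω ⟶ Δ → VS s 1ℚ
  vtr : ∀ {s α Δ x} → s ─ α ⟶ Δ → α ≢ ω
      → (f : State Act ⊤ → ℚ) → (∀ {p t} → (p , t) ∈ Δ → VS t (f t))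
      → x ≡ expect f Δ → VS s x

VDist : ∀ {Act} → Dist Act ⊤ → ℚ → Set
VDist {Act} Δ x = Σ (State Act ⊤ → ℚ) λ f → (∀ {p t} → (p , t) ∈ Δ → VS t (f t)) × x ≡ expect f Δ

_≤Ho⟨_⟩_ : {V : Set} → (V → Set) → (V → V → Set) → (V → Set) → Set
X ≤Ho⟨ _≼_ ⟩ Y = ∀ x → X x → ∃ λ y → Y y × x ≼ y

_≤Sm⟨_⟩_ : {V : Set} → (V → Set) → (V → V → Set) → (V → Set) → Set
X ≤Sm⟨ _≼_ ⟩ Y = ∀ y → Y y → ∃ λ x → X x × x ≼ y

𝒜 : ∀ {Act} → Term Act ⊤ → pCSP Act → ℚ → Set
𝒜 T P = VDist (testWith T P)

_⊑pmay_ : ∀ {Act} → pCSP Act → pCSP Act → Set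
_⊑pmay_ {Act} P Q = (T : Term Act ⊤) → 𝒜 T P ≤Ho⟨ _≤_ ⟩ 𝒜 T Q

_⊑pmust_ : ∀ {Act} → pCSP Act → pCSP Act → Set
_⊑pmust_ {Act} P Q = (T : Term Act ⊤) → 𝒜 T P ≤Sm⟨ _≤_ ⟩ 𝒜 T Q

sumFin : ∀ {k} → (Fin k → ℚ) → ℚ
sumFin {zero} g = 0ℚ
sumFin {suc k} g = g zero + sumFin (g ∘ suc)

module Vector (Ω : Set) (_≟Ω_ : DecidableEquality Ω) where

  Vec : Set
  Vec = Ω → ℚ

  _≤v_ : Vec → Vec → Set
  x ≤v y = ∀ o → x o ≤ y o

  expectV : ∀ {Act} → (State Act Ω → Vec) → Dist Act Ω → Vec
  expectV f Δ o = expect (λ t → f t o) Δ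

  bang : ∀ {Act} → Lab Act Ω → Vec → Vec
  bang (act (inj₂ o)) v o' with o ≟Ω o'
  ... | yes _ = 1ℚ
  ... | no _  = v o'
  bang _ v = v

  -- V̄^Ω_↕(s): {0⃗} if no transition, otherwise the convex closure ↕ of
  -- ⋃ { α!(V̄^Ω_↕(Δ)) : s ─α⟶ Δ }.  A member of ↕ is given by k points
  -- y_i = α_i!(Σ_t Δ_i(t) f_i(t)) with f_i(t) ∈ V̄(t), and weights λ_i.
  data VV {Act : Set} : State Act Ω → Vec → Set where
    vv0   : ∀ {s v} → NoTrans s → (∀ o → v o ≡ 0ℚ) → VV s v
    vhull : ∀ {s v} (k : ℕ) (λs : Fin k → ℚ) → (∀ i → 0ℚ ≤ λs i) → sumFin λs ≡ 1ℚ
          → (α : Fin k → Lab Act Ω) (Δ : Fin k → Dist Act Ω)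
          → (∀ i → s ─ α i ⟶ Δ i)
          → (f : Fin k → State Act Ω → Vec)
          → (∀ i {p t} → (p , t) ∈ Δ i → VV t (f i t))
          → (∀ o → v o ≡ sumFin (λ i → λs i * bang (α i) (expectV (f i) (Δ i)) o))
          → VV s v

  VVDist : ∀ {Act} → Dist Act Ω → Vec → Set
  VVDist {Act} Δ v = Σ (State Act Ω → Vec) λ f →
    (∀ {p t} → (p , t) ∈ Δ → VV t (f t)) × (∀ o → v o ≡ expectV f Δ o)

  𝒜Ω : ∀ {Act} → Term Act Ω → pCSP Act → Vec → Set
  𝒜Ω T P = VVDist (testWith T P)

  _⊑Ωpmay_ : ∀ {Act} → pCSP Act → pCSP Act → Set
  _⊑Ωpmay_ {Act} P Q = (T : Term Act Ω) → 𝒜Ω T P ≤Ho⟨ _≤v_ ⟩ 𝒜Ω T Q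

  _⊑Ωpmust_ : ∀ {Act} → pCSP Act → pCSP Act → Set
  _⊑Ωpmust_ {Act} P Q = (T : Term Act Ω) → 𝒜Ω T P ≤Sm⟨ _≤v_ ⟩ 𝒜Ω T Q

⊤-≟ : DecidableEquality ⊤
⊤-≟ tt tt = yes _≡_.refl

open Vector ⊤ ⊤-≟ public using () renaming (_⊑Ωpmay_ to _⊑Ω1pmay_; _⊑Ωpmust_ to _⊑Ω1pmust_)

-- With one success action both outcome sets of a test run, the scalar 𝒜(T,P) and the vector
-- 𝒜^Ω(T,P), have the same greatest and the same least element.  The extreme outcome of a state
-- is obtained by taking, at every step, a best transition (an ω-transition being worth 1); it is
-- attained in both semantics, and the convex closure used by the vector semantics cannot go beyond
-- it, since a convex combination lies between the extremes of its points.  Between sets having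
-- greatest elements the Hoare preorder just compares these elements, and between sets having least
-- elements the Smyth preorder compares those, so the scalar and vector preorders coincide.
module Submission where

open import Defs
open import Data.Nat using (ℕ; zero; suc; s≤s) renaming (_≤_ to _≤ₙ_; _<_ to _<ₙ_; _+_ to _+ₙ_)
import Data.Nat.Properties as ℕ
open import Data.Fin using (Fin; zero; suc)
import Data.Fin as Fin
open import Data.Bool using (Bool; true; false) renaming (_≟_ to _≟ᵇ_)
open import Data.Empty using (⊥-elim)
open import Data.Unit using (⊤; tt)
open import Data.Sum using (_⊎_; inj₁; inj₂)
open import Data.Product using (_×_; _,_; ∃; ∃₂; proj₁; proj₂)
open import Data.List using (List; []; _∷_; map; _++_; filter; cartesianProduct)
open import Data.List.Membership.Propositional using (_∈_; find)
open import Data.List.Membership.Propositional.Properties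
open import Data.List.Relation.Unary.Any using (here; there)
import Data.List.Relation.Unary.All as All
open import Data.Rational using (ℚ; 0ℚ; 1ℚ; _+_; _*_; _-_; -_; _≤_; nonNegative)
import Data.Rational.Properties as ℚ
open import Function using (_∘_)
open import Function.Bundles using (_⇔_; mk⇔; Equivalence)
open import Level using (0ℓ)
open import Relation.Binary.Bundles using (TotalOrder)
import Relation.Binary.Construct.Flip.EqAndOrd as Flip
open import Relation.Binary.Definitions using (DecidableEquality; Transitive)
open import Relation.Binary.PropositionalEquality using (_≡_; _≢_; refl; sym; trans; cong; subst)
open import Relation.Binary.Structures using (IsTotalOrder)
open import Relation.Nullary using (Dec; yes; no)
open import Relation.Unary using (Decidable)

module Transitions {Act X : Set} (_≟_ : DecidableEquality Act) where

  Move : Set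
  Move = Lab Act X × Dist Act X

  notIn? : (A : Act → Bool) → Decidable (NotIn {X = X} A)
  notIn? A τ              = yes tt
  notIn? A (act (inj₁ a)) = A a ≟ᵇ false
  notIn? A (act (inj₂ _)) = yes tt

  data Synchronise (A : Act → Bool) : Lab Act X → Lab Act X → Set where
    synchronise : ∀ {a} → A a ≡ true → Synchronise A (act (inj₁ a)) (act (inj₁ a))

  synchronise? : (A : Act → Bool) (α β : Lab Act X) → Dec (Synchronise A α β)
  synchronise? A (act (inj₁ a)) (act (inj₁ b)) with a ≟ b | A a ≟ᵇ true
  ... | yes refl | yes Aa = yes (synchronise Aa)
  ... | yes refl | no ¬Aa = no λ { (synchronise Aa) → ¬Aa Aa }
  ... | no a≢b   | _      = no λ { (synchronise _) → a≢b refl }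
  synchronise? A τ              _              = no λ ()
  synchronise? A (act (inj₂ _)) _              = no λ ()
  synchronise? A (act (inj₁ _)) τ              = no λ ()
  synchronise? A (act (inj₁ _)) (act (inj₂ _)) = no λ ()

  private
    unsynchronised? : (A : Act → Bool) → Decidable (λ (m : Move) → NotIn A (proj₁ m))
    unsynchronised? A m = notIn? A (proj₁ m)

    synchronisable? : (A : Act → Bool)
                    → Decidable (λ (mm : Move × Move) → Synchronise A (proj₁ (proj₁ mm)) (proj₁ (proj₂ mm)))
    synchronisable? A (m₁ , m₂) = synchronise? A (proj₁ m₁) (proj₁ m₂)

  choiceLeft : State Act X → Move → Move
  choiceLeft s₂ (τ , Δ)     = τ , mapD (_□ s₂) Δ
  choiceLeft s₂ (act a , Δ) = act a , Δ

  choiceRight : State Act X → Move → Move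
  choiceRight s₁ (τ , Δ)     = τ , mapD (s₁ □_) Δ
  choiceRight s₁ (act a , Δ) = act a , Δ

  interleaveLeft : (Act → Bool) → State Act X → List Move → List Move
  interleaveLeft A s₂ = map (λ (α , Δ) → α , mapD (λ t → par A t s₂) Δ) ∘ filter (unsynchronised? A)

  interleaveRight : (Act → Bool) → State Act X → List Move → List Move
  interleaveRight A s₁ = map (λ (α , Δ) → α , mapD (λ t → par A s₁ t) Δ) ∘ filter (unsynchronised? A)

  synchronisations : (Act → Bool) → List Move → List Move → List Move
  synchronisations A ms₁ ms₂ =
    map (λ ((_ , Δ₁) , (_ , Δ₂)) → τ , prodD (par A) Δ₁ Δ₂)
        (filter (synchronisable? A) (cartesianProduct ms₁ ms₂))

  transitions : State Act X → List Move
  transitions nil           = []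
  transitions (pre a P)     = (act a , ⟦ P ⟧) ∷ []
  transitions (P ⊓ Q)       = (τ , ⟦ P ⟧) ∷ (τ , ⟦ Q ⟧) ∷ []
  transitions (s₁ □ s₂)     =
    map (choiceLeft s₂) (transitions s₁) ++ map (choiceRight s₁) (transitions s₂)
  transitions (par A s₁ s₂) =
    interleaveLeft A s₂ (transitions s₁) ++ interleaveRight A s₁ (transitions s₂) ++
    synchronisations A (transitions s₁) (transitions s₂)

  transitions-complete : ∀ {s α Δ} → s ─ α ⟶ Δ → (α , Δ) ∈ transitions s
  transitions-complete pre⟶       = here refl
  transitions-complete intL       = here refl
  transitions-complete intR       = there (here refl)
  transitions-complete (extL tr)  = ∈-++⁺ˡ (∈-map⁺ (choiceLeft _) (transitions-complete tr))
  transitions-complete (extτL tr) = ∈-++⁺ˡ (∈-map⁺ (choiceLeft _) (transitions-complete tr))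
  transitions-complete (extR tr)  = ∈-++⁺ʳ _ (∈-map⁺ (choiceRight _) (transitions-complete tr))
  transitions-complete (extτR tr) = ∈-++⁺ʳ _ (∈-map⁺ (choiceRight _) (transitions-complete tr))
  transitions-complete (parL {A} tr ni) =
    ∈-++⁺ˡ (∈-map⁺ _ (∈-filter⁺ (unsynchronised? A) (transitions-complete tr) ni))
  transitions-complete (parR {A} {s₁} {s₂} tr ni) =
    ∈-++⁺ʳ (interleaveLeft A s₂ (transitions s₁))
      (∈-++⁺ˡ (∈-map⁺ _ (∈-filter⁺ (unsynchronised? A) (transitions-complete tr) ni)))
  transitions-complete (sync {A} {s₁} {s₂} tr₁ tr₂ Aa) =
    ∈-++⁺ʳ (interleaveLeft A s₂ (transitions s₁)) (∈-++⁺ʳ (interleaveRight A s₁ (transitions s₂))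
      (∈-map⁺ _ (∈-filter⁺ (synchronisable? A)
        (∈-cartesianProduct⁺ (transitions-complete tr₁) (transitions-complete tr₂)) (synchronise Aa))))

  ListsMovesOf : State Act X → List Move → Set
  ListsMovesOf s ms = ∀ {α Δ} → (α , Δ) ∈ ms → s ─ α ⟶ Δ

  private
    ++-listsMoves : ∀ {s xs ys} → ListsMovesOf s xs → ListsMovesOf s ys → ListsMovesOf s (xs ++ ys)
    ++-listsMoves {xs = xs} hxs hys m with ∈-++⁻ xs m
    ... | inj₁ m′ = hxs m′
    ... | inj₂ m′ = hys m′

    choiceLeft-listsMoves : ∀ {s₁ s₂ ms} → ListsMovesOf s₁ ms
                          → ListsMovesOf (s₁ □ s₂) (map (choiceLeft s₂) ms)
    choiceLeft-listsMoves h m with ∈-map⁻ _ m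
    ... | (τ , _)     , m′ , refl = extτL (h m′)
    ... | (act _ , _) , m′ , refl = extL (h m′)

    choiceRight-listsMoves : ∀ {s₁ s₂ ms} → ListsMovesOf s₂ ms
                           → ListsMovesOf (s₁ □ s₂) (map (choiceRight s₁) ms)
    choiceRight-listsMoves h m with ∈-map⁻ _ m
    ... | (τ , _)     , m′ , refl = extτR (h m′)
    ... | (act _ , _) , m′ , refl = extR (h m′)

    interleaveLeft-listsMoves : ∀ {A s₁ s₂ ms} → ListsMovesOf s₁ ms
                              → ListsMovesOf (par A s₁ s₂) (interleaveLeft A s₂ ms)
    interleaveLeft-listsMoves {A} h m with ∈-map⁻ _ m
    ... | _ , m′ , refl with ∈-filter⁻ (unsynchronised? A) m′
    ... | m″ , ni = parL (h m″) ni

    interleaveRight-listsMoves : ∀ {A s₁ s₂ ms} → ListsMovesOf s₂ ms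
                               → ListsMovesOf (par A s₁ s₂) (interleaveRight A s₁ ms)
    interleaveRight-listsMoves {A} h m with ∈-map⁻ _ m
    ... | _ , m′ , refl with ∈-filter⁻ (unsynchronised? A) m′
    ... | m″ , ni = parR (h m″) ni

    synchronisations-listsMoves : ∀ {A s₁ s₂ ms₁ ms₂} → ListsMovesOf s₁ ms₁ → ListsMovesOf s₂ ms₂
                                → ListsMovesOf (par A s₁ s₂) (synchronisations A ms₁ ms₂)
    synchronisations-listsMoves {A} {ms₁ = ms₁} {ms₂} h₁ h₂ m with ∈-map⁻ _ m
    ... | _ , m′ , refl with ∈-filter⁻ (synchronisable? A) {xs = cartesianProduct ms₁ ms₂} m′
    ... | m″ , synchronise Aa with ∈-cartesianProduct⁻ ms₁ ms₂ m″
    ... | m₁ , m₂ = sync (h₁ m₁) (h₂ m₂) Aa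

  transitions-sound : ∀ s → ListsMovesOf s (transitions s)
  transitions-sound (pre a P) (here refl)         = pre⟶
  transitions-sound (P ⊓ Q)   (here refl)         = intL
  transitions-sound (P ⊓ Q)   (there (here refl)) = intR
  transitions-sound (s₁ □ s₂) =
    ++-listsMoves (choiceLeft-listsMoves (transitions-sound s₁))
                  (choiceRight-listsMoves (transitions-sound s₂))
  transitions-sound (par A s₁ s₂) =
    ++-listsMoves (interleaveLeft-listsMoves (transitions-sound s₁))
      (++-listsMoves (interleaveRight-listsMoves (transitions-sound s₂))
        (synchronisations-listsMoves (transitions-sound s₁) (transitions-sound s₂)))

  transitions-noTrans : ∀ {s} → transitions s ≡ [] → NoTrans s
  transitions-noTrans eq α Δ tr with () ← subst ((α , Δ) ∈_) eq (transitions-complete tr)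

  noTrans-transitions : ∀ {s} → NoTrans s → transitions s ≡ []
  noTrans-transitions {s} nt with transitions s | transitions-sound s
  ... | []          | _     = refl
  ... | (α , Δ) ∷ _ | sound = ⊥-elim (nt α Δ (sound (here refl)))

*-nonNeg : ∀ {p q} → 0ℚ ≤ p → 0ℚ ≤ q → 0ℚ ≤ p * q
*-nonNeg {p} {q} 0≤p 0≤q =
  ℚ.nonNegative⁻¹ (p * q) {{ℚ.nonNeg*nonNeg⇒nonNeg p {{nonNegative 0≤p}} q {{nonNegative 0≤q}}}}

*-monoˡ-≤-nonNeg : ∀ {p x y} → 0ℚ ≤ p → x ≤ y → p * x ≤ p * y
*-monoˡ-≤-nonNeg {p} 0≤p = ℚ.*-monoˡ-≤-nonNeg p {{nonNegative 0≤p}}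

module _ {Act X : Set} where

  ∈-scale⁻ : ∀ q {p t} Δ → (p , t) ∈ scale {Act} {X} q Δ → ∃ λ p′ → (p′ , t) ∈ Δ × p ≡ q * p′
  ∈-scale⁻ q Δ m with ∈-map⁻ _ m
  ... | (p′ , _) , m′ , refl = p′ , m′ , refl

  ∈-⟦⊕⟧⁻ : ∀ q {p t} (P Q : Term Act X) → (p , t) ∈ scale q ⟦ P ⟧ ++ scale (1ℚ - q) ⟦ Q ⟧
          → (∃ λ p′ → (p′ , t) ∈ ⟦ P ⟧ × p ≡ q * p′) ⊎ (∃ λ p′ → (p′ , t) ∈ ⟦ Q ⟧ × p ≡ (1ℚ - q) * p′)
  ∈-⟦⊕⟧⁻ q P Q m with ∈-++⁻ (scale q ⟦ P ⟧) m
  ... | inj₁ m′ = inj₁ (∈-scale⁻ q ⟦ P ⟧ m′)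
  ... | inj₂ m′ = inj₂ (∈-scale⁻ (1ℚ - q) ⟦ Q ⟧ m′)

  ∈-mapD⁻ : ∀ {f p t} Δ → (p , t) ∈ mapD {Act} {X} f Δ → ∃ λ t′ → (p , t′) ∈ Δ × t ≡ f t′
  ∈-mapD⁻ Δ m with ∈-map⁻ _ m
  ... | (_ , t′) , m′ , refl = t′ , m′ , refl

  ∈-prodD⁻ : ∀ {f p t} Δ₁ Δ₂ → (p , t) ∈ prodD {Act} {X} f Δ₁ Δ₂
           → ∃₂ λ p₁ t₁ → ∃₂ λ p₂ t₂ → (p₁ , t₁) ∈ Δ₁ × (p₂ , t₂) ∈ Δ₂ × p ≡ p₁ * p₂ × t ≡ f t₁ t₂
  ∈-prodD⁻ Δ₁ Δ₂ m with find (∈-concatMap⁻ _ {xs = Δ₁} m)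
  ... | (p₁ , t₁) , m₁ , m′ with ∈-map⁻ _ m′
  ... | (p₂ , t₂) , m₂ , refl = p₁ , t₁ , p₂ , t₂ , m₁ , m₂ , refl , refl

  mutual
    termSize : Term Act X → ℕ
    termSize (st s)           = stateSize s
    termSize (⊕⟨ _ ⟩ _ _ P Q) = termSize P +ₙ termSize Q

    stateSize : State Act X → ℕ
    stateSize nil           = 0
    stateSize (pre _ P)     = suc (termSize P)
    stateSize (P ⊓ Q)       = suc (termSize P +ₙ termSize Q)
    stateSize (s₁ □ s₂)     = suc (stateSize s₁ +ₙ stateSize s₂)
    stateSize (par _ s₁ s₂) = suc (stateSize s₁ +ₙ stateSize s₂)

  ⟦⟧-size : ∀ {p t} (P : Term Act X) → (p , t) ∈ ⟦ P ⟧ → stateSize t ≤ₙ termSize P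
  ⟦⟧-size (st s) (here refl) = ℕ.≤-refl
  ⟦⟧-size (⊕⟨ q ⟩ _ _ P Q) m with ∈-⟦⊕⟧⁻ q P Q m
  ... | inj₁ (_ , m′ , _) = ℕ.≤-trans (⟦⟧-size P m′) (ℕ.m≤m+n (termSize P) (termSize Q))
  ... | inj₂ (_ , m′ , _) = ℕ.≤-trans (⟦⟧-size Q m′) (ℕ.m≤n+m (termSize Q) (termSize P))

  transition-size : ∀ {s α Δ p t} → s ─ α ⟶ Δ → (p , t) ∈ Δ → stateSize t <ₙ stateSize s
  transition-size (pre⟶ {P = P}) m = s≤s (⟦⟧-size P m)
  transition-size (intL {P} {Q}) m = s≤s (ℕ.≤-trans (⟦⟧-size P m) (ℕ.m≤m+n (termSize P) (termSize Q)))
  transition-size (intR {P} {Q}) m = s≤s (ℕ.≤-trans (⟦⟧-size Q m) (ℕ.m≤n+m (termSize Q) (termSize P)))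
  transition-size (extL {s₁} {s₂} tr) m =
    ℕ.m≤n⇒m≤1+n (ℕ.≤-trans (transition-size tr m) (ℕ.m≤m+n (stateSize s₁) (stateSize s₂)))
  transition-size (extR {s₁} {s₂} tr) m =
    ℕ.m≤n⇒m≤1+n (ℕ.≤-trans (transition-size tr m) (ℕ.m≤n+m (stateSize s₂) (stateSize s₁)))
  transition-size (extτL {s₂ = s₂} {Δ} tr) m with ∈-mapD⁻ Δ m
  ... | _ , m′ , refl = s≤s (ℕ.+-monoˡ-< (stateSize s₂) (transition-size tr m′))
  transition-size (extτR {s₁} {Δ = Δ} tr) m with ∈-mapD⁻ Δ m
  ... | _ , m′ , refl = s≤s (ℕ.+-monoʳ-< (stateSize s₁) (transition-size tr m′))
  transition-size (parL {s₂ = s₂} {Δ = Δ} tr _) m with ∈-mapD⁻ Δ m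
  ... | _ , m′ , refl = s≤s (ℕ.+-monoˡ-< (stateSize s₂) (transition-size tr m′))
  transition-size (parR {s₁ = s₁} {Δ = Δ} tr _) m with ∈-mapD⁻ Δ m
  ... | _ , m′ , refl = s≤s (ℕ.+-monoʳ-< (stateSize s₁) (transition-size tr m′))
  transition-size (sync {Δ₁ = Δ₁} {Δ₂} tr₁ tr₂ _) m with ∈-prodD⁻ Δ₁ Δ₂ m
  ... | _ , _ , _ , _ , m₁ , m₂ , _ , refl =
    s≤s (ℕ.+-mono-<-≤ (transition-size tr₁ m₁) (ℕ.<⇒≤ (transition-size tr₂ m₂)))

  NonNegWeights : Dist Act X → Set
  NonNegWeights Δ = ∀ {p t} → (p , t) ∈ Δ → 0ℚ ≤ p

  ⟦⟧-nonNeg : ∀ P → NonNegWeights ⟦ P ⟧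
  ⟦⟧-nonNeg (st s) (here refl) = ℚ.nonNegative⁻¹ 1ℚ
  ⟦⟧-nonNeg (⊕⟨ q ⟩ 0<q q<1 P Q) m with ∈-⟦⊕⟧⁻ q P Q m
  ... | inj₁ (_ , m′ , refl) = *-nonNeg (ℚ.<⇒≤ 0<q) (⟦⟧-nonNeg P m′)
  ... | inj₂ (_ , m′ , refl) = *-nonNeg 0≤1-q (⟦⟧-nonNeg Q m′)
    where
    0≤1-q : 0ℚ ≤ 1ℚ - q
    0≤1-q = subst (_≤ 1ℚ - q) (ℚ.+-inverseʳ q) (ℚ.+-monoˡ-≤ (- q) (ℚ.<⇒≤ q<1))

  mapD-nonNeg : ∀ f Δ → NonNegWeights Δ → NonNegWeights (mapD f Δ)
  mapD-nonNeg f Δ h m with ∈-mapD⁻ Δ m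
  ... | _ , m′ , _ = h m′

  prodD-nonNeg : ∀ f Δ₁ Δ₂ → NonNegWeights Δ₁ → NonNegWeights Δ₂ → NonNegWeights (prodD f Δ₁ Δ₂)
  prodD-nonNeg f Δ₁ Δ₂ h₁ h₂ m with ∈-prodD⁻ Δ₁ Δ₂ m
  ... | _ , _ , _ , _ , m₁ , m₂ , refl , _ = *-nonNeg (h₁ m₁) (h₂ m₂)

  transition-nonNeg : ∀ {s α Δ} → s ─ α ⟶ Δ → NonNegWeights Δ
  transition-nonNeg (pre⟶ {P = P})        = ⟦⟧-nonNeg P
  transition-nonNeg (intL {P})             = ⟦⟧-nonNeg P
  transition-nonNeg (intR {Q = Q})         = ⟦⟧-nonNeg Q
  transition-nonNeg (extL tr)              = transition-nonNeg tr
  transition-nonNeg (extR tr)              = transition-nonNeg tr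
  transition-nonNeg (extτL {Δ = Δ} tr)     = mapD-nonNeg _ Δ (transition-nonNeg tr)
  transition-nonNeg (extτR {Δ = Δ} tr)     = mapD-nonNeg _ Δ (transition-nonNeg tr)
  transition-nonNeg (parL {Δ = Δ} tr _)    = mapD-nonNeg _ Δ (transition-nonNeg tr)
  transition-nonNeg (parR {Δ = Δ} tr _)    = mapD-nonNeg _ Δ (transition-nonNeg tr)
  transition-nonNeg (sync {Δ₁ = Δ₁} {Δ₂} tr₁ tr₂ _) =
    prodD-nonNeg _ Δ₁ Δ₂ (transition-nonNeg tr₁) (transition-nonNeg tr₂)

  testWith-nonNeg : ∀ T P → NonNegWeights (testWith T P)
  testWith-nonNeg T P = prodD-nonNeg _ ⟦ T ⟧ ⟦ embT P ⟧ (⟦⟧-nonNeg T) (⟦⟧-nonNeg (embT P))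

Greatest : {V : Set} → (V → V → Set) → (V → Set) → V → Set
Greatest _≼_ X a = X a × (∀ x → X x → x ≼ a)

≤Ho-greatest⇔ : ∀ {V : Set} {_≼_ : V → V → Set} {X Y : V → Set} {a b} → Transitive _≼_
              → Greatest _≼_ X a → Greatest _≼_ Y b → (X ≤Ho⟨ _≼_ ⟩ Y) ⇔ (a ≼ b)
≤Ho-greatest⇔ {_≼_ = _≼_} {X} {Y} {a} ≼-trans (Xa , X≼a) (Yb , Y≼b) = mk⇔
  (λ (X≤Y : X ≤Ho⟨ _≼_ ⟩ Y) → let y , Yy , a≼y = X≤Y a Xa in ≼-trans a≼y (Y≼b y Yy))
  (λ a≼b x Xx → _ , Yb , ≼-trans (X≼a x Xx) a≼b)

∀-cong-⇔ : ∀ {I : Set} {A B : I → Set} → (∀ i → A i ⇔ B i) → (∀ i → A i) ⇔ (∀ i → B i)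
∀-cong-⇔ A⇔B = mk⇔ (λ a i → Equivalence.to (A⇔B i) (a i)) (λ b i → Equivalence.from (A⇔B i) (b i))

open Vector ⊤ ⊤-≟ using (VV; vv0; vhull; bang; expectV; VVDist; 𝒜Ω)

scalarBang : ∀ {Act} → Lab Act ⊤ → ℚ → ℚ
scalarBang (act (inj₂ _)) _ = 1ℚ
scalarBang τ              x = x
scalarBang (act (inj₁ _)) x = x

scalarBang-bang : ∀ {Act} (α : Lab Act ⊤) x o → scalarBang α x ≡ bang α (λ _ → x) o
scalarBang-bang (act (inj₂ _)) x o = refl
scalarBang-bang τ              x o = refl
scalarBang-bang (act (inj₁ _)) x o = refl

scalarBang-≢ω : ∀ {Act} {α : Lab Act ⊤} {x} → α ≢ ω → scalarBang α x ≡ x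
scalarBang-≢ω {α = act (inj₂ _)} α≢ω = ⊥-elim (α≢ω refl)
scalarBang-≢ω {α = τ}            _   = refl
scalarBang-≢ω {α = act (inj₁ _)} _   = refl

-- Instantiated with ≤ it describes greatest outcomes, with the flipped order least ones.
module Extremum {Act : Set} (_≟_ : DecidableEquality Act)
  {_≼_ : ℚ → ℚ → Set} (≼-isTotalOrder : IsTotalOrder _≡_ _≼_)
  (+-mono-≼ : ∀ {w x y z} → w ≼ x → y ≼ z → (w + y) ≼ (x + z))
  (*-monoˡ-≼ : ∀ {p x y} → 0ℚ ≤ p → x ≼ y → (p * x) ≼ (p * y))
  where

  open IsTotalOrder ≼-isTotalOrder using () renaming (refl to ≼-refl; trans to ≼-trans)
  open Transitions {Act} {⊤} _≟_

  ≼-totalOrder : TotalOrder 0ℓ 0ℓ 0ℓ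
  ≼-totalOrder = record { isTotalOrder = ≼-isTotalOrder }

  open import Data.List.Extrema ≼-totalOrder
    using (argmax; argmax-all; f[⊥]≤f[argmax]; f[xs]≤f[argmax])

  ≼-reflexive : ∀ {x y} → x ≡ y → x ≼ y
  ≼-reflexive refl = ≼-refl

  expect-mono : ∀ {X} {f g : State Act X → ℚ} Δ → NonNegWeights Δ
              → (∀ {p t} → (p , t) ∈ Δ → f t ≼ g t) → expect f Δ ≼ expect g Δ
  expect-mono []            _  _ = ≼-refl
  expect-mono ((p , s) ∷ Δ) nn h =
    +-mono-≼ (*-monoˡ-≼ (nn (here refl)) (h (here refl))) (expect-mono Δ (nn ∘ there) (h ∘ there))

  convex-≼ : ∀ {k} (λs c : Fin k → ℚ) {b} → (∀ i → 0ℚ ≤ λs i) → (∀ i → c i ≼ b)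
           → sumFin (λ i → λs i * c i) ≼ (sumFin λs * b)
  convex-≼ {zero}  λs c {b} _   _   = ≼-reflexive (sym (ℚ.*-zeroˡ b))
  convex-≼ {suc k} λs c {b} 0≤λ c≼b =
    ≼-trans (+-mono-≼ (*-monoˡ-≼ (0≤λ zero) (c≼b zero))
                      (convex-≼ (λs ∘ suc) (c ∘ suc) (0≤λ ∘ suc) (c≼b ∘ suc)))
            (≼-reflexive (sym (ℚ.*-distribʳ-+ b (λs zero) (sumFin (λs ∘ suc)))))

  best : (Move → ℚ) → List Move → ℚ
  best g []       = 0ℚ
  best g (m ∷ ms) = g (argmax g m ms)

  best-elim : ∀ (P : ℚ → Set) g ms → (ms ≡ [] → P 0ℚ) → (∀ {m} → m ∈ ms → P (g m)) → P (best g ms)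
  best-elim P g []       h₀ _ = h₀ refl
  best-elim P g (m ∷ ms) _  h = argmax-all g {P = P ∘ g} (h (here refl)) (All.tabulate (h ∘ there))

  ≼-best : ∀ g {m ms} → m ∈ ms → g m ≼ best g ms
  ≼-best g {ms = m ∷ ms}  (here refl) = f[⊥]≤f[argmax] {f = g} m ms
  ≼-best g {ms = m′ ∷ ms} (there m∈)  = All.lookup (f[xs]≤f[argmax] {f = g} m′ ms) m∈

  moveValue : (State Act ⊤ → ℚ) → Move → ℚ
  moveValue v (α , Δ) = scalarBang α (expect v Δ)

  -- k is fuel: value k s is the extreme outcome of s as soon as stateSize s < k.
  value : ℕ → State Act ⊤ → ℚ
  value zero    _ = 0ℚ
  value (suc k) s = best (moveValue (value k)) (transitions s)

  move≼value : ∀ k {s : State Act ⊤} {α Δ} → s ─ α ⟶ Δ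
             → scalarBang α (expect (value k) Δ) ≼ value (suc k) s
  move≼value k tr = ≼-best (moveValue (value k)) (transitions-complete tr)

  value-noTrans : ∀ k {s : State Act ⊤} → NoTrans s → value (suc k) s ≡ 0ℚ
  value-noTrans k nt = cong (best (moveValue (value k))) (noTrans-transitions nt)

  private
    successor-size : ∀ {k} {s : State Act ⊤} {α Δ p t} → stateSize s <ₙ suc k → s ─ α ⟶ Δ
                   → (p , t) ∈ Δ → stateSize t <ₙ k
    successor-size s<k tr m = ℕ.<-≤-trans (transition-size tr m) (ℕ.≤-pred s<k)

  VS-step : ∀ {s : State Act ⊤} {α Δ x} → s ─ α ⟶ Δ → VDist Δ x → VS s (scalarBang α x)
  VS-step {α = act (inj₂ _)} tr _              = vω tr
  VS-step {α = τ}            tr (f , hf , x≡) = vtr tr (λ ()) f hf x≡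
  VS-step {α = act (inj₁ _)} tr (f , hf , x≡) = vtr tr (λ ()) f hf x≡

  VS-value : ∀ k s → stateSize s <ₙ k → VS s (value k s)
  VS-value (suc k) s s<k = best-elim (VS s) (moveValue (value k)) (transitions s)
    (λ none → v0 (transitions-noTrans none))
    (λ m → let tr = transitions-sound s m in
           VS-step tr (value k , (λ m′ → VS-value k _ (successor-size s<k tr m′)) , refl))

  VS≼value : ∀ k s → stateSize s <ₙ k → ∀ {x} → VS s x → x ≼ value k s
  VS≼value (suc k) s s<k (v0 nt) = ≼-reflexive (sym (value-noTrans k nt))
  VS≼value (suc k) s s<k (vω tr) = move≼value k tr
  VS≼value (suc k) s s<k (vtr {Δ = Δ} tr α≢ω f hf refl) =
    ≼-trans (expect-mono Δ (transition-nonNeg tr) (λ m → VS≼value k _ (successor-size s<k tr m) (hf m)))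
            (≼-trans (≼-reflexive (sym (scalarBang-≢ω α≢ω))) (move≼value k tr))

  -- A single transition, as the convex combination with one point of weight 1.
  VV-step : ∀ {s : State Act ⊤} {α Δ v} (f : State Act ⊤ → ⊤ → ℚ) → s ─ α ⟶ Δ
          → (∀ {p t} → (p , t) ∈ Δ → VV t (f t)) → (∀ o → v o ≡ bang α (expectV f Δ) o) → VV s v
  VV-step f tr hf v≡ =
    vhull 1 (λ _ → 1ℚ) (λ _ → ℚ.nonNegative⁻¹ 1ℚ) (ℚ.+-identityʳ 1ℚ) (λ _ → _) (λ _ → _) (λ _ → tr)
      (λ _ → f) (λ _ → hf) (λ o → trans (v≡ o) (sym (trans (ℚ.+-identityʳ _) (ℚ.*-identityˡ _))))

  VV-value : ∀ k s → stateSize s <ₙ k → VV s (λ _ → value k s)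
  VV-value (suc k) s s<k = best-elim (λ x → VV s (λ _ → x)) (moveValue (value k)) (transitions s)
    (λ none → vv0 (transitions-noTrans none) (λ _ → refl))
    (λ {(α , Δ)} m → let tr = transitions-sound s m in
      VV-step (λ t _ → value k t) tr (λ m′ → VV-value k _ (successor-size s<k tr m′))
        (scalarBang-bang α (expect (value k) Δ)))

  bang≼scalarBang : ∀ (α : Lab Act ⊤) {u y} → u tt ≼ y → bang α u tt ≼ scalarBang α y
  bang≼scalarBang (act (inj₂ _)) _ = ≼-refl
  bang≼scalarBang τ              h = h
  bang≼scalarBang (act (inj₁ _)) h = h

  VV≼value : ∀ k s → stateSize s <ₙ k → ∀ {v} → VV s v → v tt ≼ value k s
  VV≼value (suc k) s s<k (vv0 nt v≡0) = ≼-reflexive (trans (v≡0 tt) (sym (value-noTrans k nt)))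
  VV≼value (suc k) s s<k (vhull _ λs 0≤λ Σλ≡1 α Δ tr f hf v≡) =
    ≼-trans (≼-reflexive (v≡ tt))
      (≼-trans (convex-≼ λs (λ i → bang (α i) (expectV (f i) (Δ i)) tt) 0≤λ point≼value)
               (≼-reflexive (trans (cong (_* value (suc k) s) Σλ≡1) (ℚ.*-identityˡ _))))
    where
    point≼value : ∀ i → bang (α i) (expectV (f i) (Δ i)) tt ≼ value (suc k) s
    point≼value i = ≼-trans
      (bang≼scalarBang (α i) (expect-mono (Δ i) (transition-nonNeg (tr i))
        (λ m → VV≼value k _ (successor-size s<k (tr i) m) (hf i m))))
      (move≼value k (tr i))

  extremum : State Act ⊤ → ℚ
  extremum s = value (suc (stateSize s)) s

  outcomes-greatest : ∀ Δ → NonNegWeights Δ → Greatest _≼_ (VDist Δ) (expect extremum Δ)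
  outcomes-greatest Δ nn =
    (extremum , (λ {_} {t} _ → VS-value _ t ℕ.≤-refl) , refl) ,
    λ { _ (f , hf , refl) → expect-mono Δ nn (λ {_} {t} m → VS≼value _ t ℕ.≤-refl (hf m)) }

  vector-outcomes-greatest : ∀ Δ → NonNegWeights Δ
                           → Greatest (λ u v → ∀ o → u o ≼ v o) (VVDist Δ) (λ _ → expect extremum Δ)
  vector-outcomes-greatest Δ nn =
    ((λ t _ → extremum t) , (λ {_} {t} _ → VV-value _ t ℕ.≤-refl) , (λ _ → refl)) ,
    λ { _ (f , hf , v≡) _ → ≼-trans (≼-reflexive (v≡ tt))
                               (expect-mono Δ nn (λ {_} {t} m → VV≼value _ t ℕ.≤-refl (hf m))) }

  vector⇔scalar : ∀ T P Q → (𝒜Ω T P ≤Ho⟨ (λ u v → ∀ o → u o ≼ v o) ⟩ 𝒜Ω T Q) ⇔ (𝒜 T P ≤Ho⟨ _≼_ ⟩ 𝒜 T Q)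
  vector⇔scalar T P Q =
    mk⇔ (λ h → Scalar.from (Pointwise.to h tt)) (λ h → Pointwise.from (λ _ → Scalar.to h))
    where
    module Scalar = Equivalence (≤Ho-greatest⇔ ≼-trans
      (outcomes-greatest _ (testWith-nonNeg T P)) (outcomes-greatest _ (testWith-nonNeg T Q)))
    module Pointwise = Equivalence (≤Ho-greatest⇔ (λ h h′ o → ≼-trans (h o) (h′ o))
      (vector-outcomes-greatest _ (testWith-nonNeg T P)) (vector-outcomes-greatest _ (testWith-nonNeg T Q)))

-- X ≤Sm⟨ _≤_ ⟩ Y is, by definition, Y ≤Ho⟨ flip _≤_ ⟩ X.
module _ {Act : Set} (_≟_ : DecidableEquality Act) where
  module Maximum = Extremum _≟_ ℚ.≤-isTotalOrder ℚ.+-mono-≤ *-monoˡ-≤-nonNeg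
  module Minimum = Extremum _≟_ (Flip.isTotalOrder ℚ.≤-isTotalOrder) ℚ.+-mono-≤ *-monoˡ-≤-nonNeg

corollary6p3 : (n : ℕ) (P Q : pCSP (Fin n))
    → ((P ⊑Ω1pmay Q) ⇔ (P ⊑pmay Q)) × ((P ⊑Ω1pmust Q) ⇔ (P ⊑pmust Q))
corollary6p3 n P Q =
  ∀-cong-⇔ (λ T → Maximum.vector⇔scalar Fin._≟_ T P Q) ,
  ∀-cong-⇔ (λ T → Minimum.vector⇔scalar Fin._≟_ T Q P)
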